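{- Let $\mathbb{S}$ be any set of 2-systems and $\mathbb{H}$ any set of hypersequent rules such that for every $\textit{Sys}\in\mathbb{S}$ the hypersequent rule $\textit{Hr}_{\textit{Sys}}$ belongs to $\mathbb{H}$. If the sequent $\Gamma\Rightarrow\Pi$ is derivable in $\mathrm{LJ}+\mathbb{S}$, then $\Gamma\Rightarrow\Pi$ (viewed as a one-component hypersequent) is derivable in $\mathrm{HLJ}+\mathbb{H}$.
   Context: Sequents have the form $\Gamma\Rightarrow\Pi$ with $\Gamma$ a finite multiset of propositional intuitionistic formulae and $\Pi$ containing at most one formula. $\mathrm{LJ}$ is the standard propositional sequent calculus for intuitionistic logic with axioms $\varphi\Rightarrow\varphi$, $\bot\Rightarrow\Pi$, the left/right rules for $\wedge,\vee,\to$, internal weakening, internal contraction and cut. A hypersequent is a finite multiset of sequents (components) written $\Gamma_1\Rightarrow\Pi_1\mid\dots\mid\Gamma_k\Rightarrow\Pi_k$. $\mathrm{HLJ}$ has the same axioms and the rules of $\mathrm{LJ}$ with an arbitrary hypersequent context $G$ added to the conclusion and to every premiss (shared by all premisses), plus external weakening (from $G$ infer $G\mid\Gamma\Rightarrow\Pi$) and external contraction (from $G\mid\Gamma\Rightarrow\Pi\mid\Gamma\Rightarrow\Pi$ infer $G\mid\Gamma\Rightarrow\Pi$). For a calculus $\mathcal C$ and set of rules $\mathbb R$, $\mathcal C+\mathbb R$ is $\mathcal C$ extended by $\mathbb R$. A 2-system is a set of sequent rules $\{(r_1),\dots,(r_k),(r_B)\}$ (top rules $(r_i)$, bottom rule $(r_B)$)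 that may only be used as follows: $(r_B)$ infers $\Gamma\Rightarrow\Pi$ from $k$ premisses all equal to $\Gamma\Rightarrow\Pi$, where the derivation $\mathcal D_i$ of the $i$-th premiss may contain (possibly several) applications of the top rule $(r_i)$, which has the form: from $\Sigma_1,\Gamma'\Rightarrow\Pi'\ \dots\ \Sigma_n,\Gamma'\Rightarrow\Pi'$ infer $\Sigma_0,\Gamma'\Rightarrow\Pi'$, all applications of the top rules of the same instance acting on the same multisets $\Sigma_0,\dots,\Sigma_n$ (top rules are only applicable in this way, above the premisses of their bottom rule, which discharges them). Given a 2-system $\textit{Sys}$ whose top rule $(r_i)$ ($1\le i\le k$) infers $\theta_i^1,\dots,\theta_i^{n_i},\Gamma_i\Rightarrow\Pi_i$ from premisses $S_i^1,\dots,S_i^{p_i}$ (each of the form (list of formulae), $\Gamma_i\Rightarrow\Pi_i$), the hypersequent rule $\textit{Hr}_{\textit{Sys}}$ infers $G\mid\theta_1^1,\dots,\theta_1^{n_1},\Gamma_1\Rightarrow\Pi_1\mid\dots\mid\theta_k^1,\dots,\theta_k^{n_k},\Gamma_k\Rightarrow\Pi_k$ from the premisses $G\mid S_i^j$ for all $1\le i\le k$, $1\le j\le p_i$. -}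

module Defs where

open import Data.Nat using (ℕ)
open import Data.Fin using (Fin)
open import Data.Maybe using (Maybe; just; nothing)
open import Data.List using (List; []; _∷_; _++_; [_]; tabulate; concatMap; map; allFin)
open import Data.List.Relation.Unary.All using (All)
open import Data.List.Membership.Propositional using (_∈_)
open import Data.List.Relation.Binary.Permutation.Propositional using (_↭_)

infixr 30 _∧_ _∨_
infixr 25 _⊃_
infix 4 _⇒_

data Fm : Set where
  atom : ℕ → Fm
  ⊥′   : Fm
  _∧_ _∨_ _⊃_ : Fm → Fm → Fm

-- Sequent Γ ⇒ Π : Γ a finite multiset (list, up to the exchange rule),
-- Π at most one formula.
data Seq : Set where
  _⇒_ : List Fm → Maybe Fm → Seq

-- Hypersequent: finite multiset (list, up to external exchange) of sequents.
HSeq : Set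
HSeq = List Seq

-- Rule instances of LJ (without exchange): premisses, conclusion.
data LJRule : List Seq → Seq → Set where
  ax   : ∀ φ → LJRule [] ([ φ ] ⇒ just φ)
  ⊥L   : ∀ Π → LJRule [] ([ ⊥′ ] ⇒ Π)
  ∧L   : ∀ A B Γ Π → LJRule ((A ∷ B ∷ Γ ⇒ Π) ∷ []) (A ∧ B ∷ Γ ⇒ Π)
  ∧R   : ∀ A B Γ → LJRule ((Γ ⇒ just A) ∷ (Γ ⇒ just B) ∷ []) (Γ ⇒ just (A ∧ B))
  ∨L   : ∀ A B Γ Π → LJRule ((A ∷ Γ ⇒ Π) ∷ (B ∷ Γ ⇒ Π) ∷ []) (A ∨ B ∷ Γ ⇒ Π)
  ∨R₁  : ∀ A B Γ → LJRule ((Γ ⇒ just A) ∷ []) (Γ ⇒ just (A ∨ B))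
  ∨R₂  : ∀ A B Γ → LJRule ((Γ ⇒ just B) ∷ []) (Γ ⇒ just (A ∨ B))
  ⊃L   : ∀ A B Γ Π → LJRule ((Γ ⇒ just A) ∷ (B ∷ Γ ⇒ Π) ∷ []) (A ⊃ B ∷ Γ ⇒ Π)
  ⊃R   : ∀ A B Γ → LJRule ((A ∷ Γ ⇒ just B) ∷ []) (Γ ⇒ just (A ⊃ B))
  WL   : ∀ A Γ Π → LJRule ((Γ ⇒ Π) ∷ []) (A ∷ Γ ⇒ Π)
  WR   : ∀ A Γ → LJRule ((Γ ⇒ nothing) ∷ []) (Γ ⇒ just A)
  CL   : ∀ A Γ Π → LJRule ((A ∷ A ∷ Γ ⇒ Π) ∷ []) (A ∷ Γ ⇒ Π)
  cut  : ∀ A Γ Δ Π → LJRule ((Γ ⇒ just A) ∷ (A ∷ Δ ⇒ Π) ∷ []) (Γ ++ Δ ⇒ Π)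

-- An instance of a top rule: from Σ₁,Γ'⇒Π' … Σₙ,Γ'⇒Π' infer Σ₀,Γ'⇒Π'
-- (Σ₀ = conc, [Σ₁,…,Σₙ] = prems; Γ',Π' arbitrary at each application).
record TopInst : Set where
  constructor topInst
  field
    conc  : List Fm
    prems : List (List Fm)
open TopInst public

-- A 2-system {(r₁),…,(r_k),(r_B)}: an instance ι (e.g. an instantiation of
-- the schematic variables) fixes the multisets Σ₀,…,Σₙ of every top rule (rᵢ).
-- The bottom rule (r_B) has k premisses, all equal to its conclusion.
record TwoSystem : Set₁ where
  field
    k    : ℕ
    Inst : Set
    top  : Inst → Fin k → TopInst
open TwoSystem public

-- Derivability in LJ + 𝕊.  A is the list of top-rule instances currently
-- available (i.e. discharged by a bottom rule application further below).
data Der (𝕊 : TwoSystem → Set) (A : List TopInst) : Seq → Set₁ where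
  lj   : ∀ {ps c} → LJRule ps c → All (Der 𝕊 A) ps → Der 𝕊 A c
  exch : ∀ {Γ Γ' Π} → Γ ↭ Γ' → Der 𝕊 A (Γ ⇒ Π) → Der 𝕊 A (Γ' ⇒ Π)
  topR : ∀ {t Γ Π} → t ∈ A →
         All (λ Σ → Der 𝕊 A (Σ ++ Γ ⇒ Π)) (prems t) →
         Der 𝕊 A (conc t ++ Γ ⇒ Π)
  botR : ∀ {s} (Sys : TwoSystem) → 𝕊 Sys → (ι : Inst Sys) →
         ((i : Fin (k Sys)) → Der 𝕊 (top Sys ι i ∷ A) s) →
         Der 𝕊 A s

_⊢LJ+_ : Seq → (TwoSystem → Set) → Set₁
s ⊢LJ+ 𝕊 = Der 𝕊 [] s

HRule : Set₁
HRule = List HSeq → HSeq → Set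

data HrInst (Sys : TwoSystem) : HRule where
  hr : (ι : Inst Sys) (G : HSeq) (Γ : Fin (k Sys) → List Fm) (Π : Fin (k Sys) → Maybe Fm) →
       HrInst Sys
         (concatMap (λ i → map (λ Σ → G ++ [ Σ ++ Γ i ⇒ Π i ]) (prems (top Sys ι i))) (allFin (k Sys)))
         (G ++ tabulate (λ i → conc (top Sys ι i) ++ Γ i ⇒ Π i))

Hr : TwoSystem → HRule
Hr = HrInst

data HDer (ℍ : HRule → Set) : HSeq → Set₁ where
  hlj  : ∀ {ps c} (G : HSeq) → LJRule ps c →
         All (λ p → HDer ℍ (G ++ [ p ])) ps → HDer ℍ (G ++ [ c ])
  iexch : ∀ (G : HSeq) {Γ Γ' Π} → Γ ↭ Γ' → HDer ℍ (G ++ [ Γ ⇒ Π ]) → HDer ℍ (G ++ [ Γ' ⇒ Π ])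
  eexch : ∀ {G G'} → G ↭ G' → HDer ℍ G → HDer ℍ G'
  EW   : ∀ G s → HDer ℍ G → HDer ℍ (G ++ [ s ])
  EC   : ∀ G s → HDer ℍ (G ++ s ∷ s ∷ []) → HDer ℍ (G ++ [ s ])
  rule : ∀ {ps c} (R : HRule) → ℍ R → R ps c → All (HDer ℍ) ps → HDer ℍ c

module Submission where

-- A derivation of s using the top-rule instances A is translated into a
-- derivation of the hypersequent s | C, for every side hypersequent C that is
-- equipped with a *handler* for A: a way to perform an application of a top
-- rule t ∈ A as a hypersequent step in any context C' ⊇ C.  LJ rules are
-- simulated componentwise in HLJ, and top-rule applications are passed to the
-- handler.  A bottom rule with top rules (r₁),…,(r_k) is simulated by
-- translating its premiss derivations one after another: when the derivation
-- of premiss i applies (r_i) with side sequent Γ ⇒ Π, that application is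
-- *recorded* as the new component Σ₀,Γ ⇒ Π and the process moves on to
-- premiss i+1 in the enlarged context.  If a derivation never applies its top
-- rule we obtain s | C directly and contract; once every top rule has been
-- recorded, Hr_Sys joins the recorded components, which are then contracted
-- away.

open import Defs
open import Data.Fin using (Fin)
open import Data.Fin.Properties using (_≟_)
open import Data.Maybe using (Maybe)
open import Data.List using (List; []; _∷_; _++_; [_]; tabulate; allFin)
open import Data.List.Properties using (++-assoc; ++-identityʳ)
open import Data.List.Relation.Unary.All as All using (All; []; _∷_)
open import Data.List.Relation.Unary.All.Properties using (concat⁺; map⁺; tabulate⁺)
open import Data.List.Relation.Unary.Any using (here; there)
open import Data.List.Membership.Propositional using (_∈_)
open import Data.List.Membership.Propositional.Properties using (∈-∃++; ∈-allFin; ∈-++⁺ʳ)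
open import Data.List.Relation.Binary.Permutation.Propositional using (_↭_; ↭-sym; ↭-trans; prep)
open import Data.List.Relation.Binary.Permutation.Propositional.Properties using (++-comm; shift)
open import Data.Product using (_,_)
open import Data.Sum using (_⊎_; inj₁; inj₂; [_,_]′)
open import Data.Empty using (⊥-elim)
open import Function using (id; _∘_)
open import Relation.Nullary using (yes; no)
open import Relation.Binary.PropositionalEquality using (refl; sym; subst)

_⊆_ : HSeq → HSeq → Set
G ⊆ G' = ∀ {s} → s ∈ G → s ∈ G'

module Structural {ℍ : HRule → Set} where

  weakenAll : ∀ G G' → HDer ℍ G → HDer ℍ (G ++ G')
  weakenAll G []        d = subst (HDer ℍ) (sym (++-identityʳ G)) d
  weakenAll G (s ∷ G')  d =
    subst (HDer ℍ) (++-assoc G [ s ] G') (weakenAll (G ++ [ s ]) G' (EW G s d))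

  contract : ∀ {s G} → s ∈ G → HDer ℍ (s ∷ G) → HDer ℍ G
  contract {s} s∈G d with ∈-∃++ s∈G
  ... | ys , zs , refl =
    eexch (↭-sym (shift s ys zs))
      (eexch (++-comm (ys ++ zs) [ s ]) (EC (ys ++ zs) s (eexch duplicate-last d)))
    where
      duplicate-last : s ∷ ys ++ [ s ] ++ zs ↭ (ys ++ zs) ++ s ∷ s ∷ []
      duplicate-last = ↭-trans (prep s (shift s ys zs)) (++-comm (s ∷ s ∷ []) (ys ++ zs))

  contractAll : ∀ G G' → G ⊆ G' → HDer ℍ (G ++ G') → HDer ℍ G'
  contractAll []      G' G⊆G' d = d
  contractAll (s ∷ G) G' G⊆G' d =
    contractAll G G' (G⊆G' ∘ there) (contract (∈-++⁺ʳ G (G⊆G' (here refl))) d)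

  monotone : ∀ {G G'} → G ⊆ G' → HDer ℍ G → HDer ℍ G'
  monotone {G} {G'} G⊆G' d = contractAll G G' G⊆G' (weakenAll G G' d)

  monotoneTail : ∀ {s C C'} → C ⊆ C' → HDer ℍ (s ∷ C) → HDer ℍ (s ∷ C')
  monotoneTail C⊆C' = monotone λ { (here e) → here e ; (there m) → there (C⊆C' m) }

  -- The rules of HLJ act on the last component; these move it to the front and back.
  toEnd : ∀ {s C} → HDer ℍ (s ∷ C) → HDer ℍ (C ++ [ s ])
  toEnd {s} {C} = eexch (++-comm [ s ] C)

  fromEnd : ∀ {s C} → HDer ℍ (C ++ [ s ]) → HDer ℍ (s ∷ C)
  fromEnd {s} {C} = eexch (++-comm C [ s ])

module Translation (𝕊 : TwoSystem → Set) (ℍ : HRule → Set)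
                   (Hr∈ℍ : ∀ Sys → 𝕊 Sys → ℍ (Hr Sys)) where
  open Structural {ℍ}

  Handler : HSeq → List TopInst → Set₁
  Handler C A = ∀ {C'} → C ⊆ C' → ∀ {t Γ Π} → t ∈ A →
    All (λ Σ → HDer ℍ ((Σ ++ Γ ⇒ Π) ∷ C')) (prems t) → HDer ℍ ((conc t ++ Γ ⇒ Π) ∷ C')

  module BottomRule (Sys : TwoSystem) (Sys∈𝕊 : 𝕊 Sys) (ι : Inst Sys)
                    {A : List TopInst} {s : Seq} {C₀ : HSeq} (O₀ : Handler C₀ A)
                    (premiss : ∀ i {C} → Handler C (top Sys ι i ∷ A) → HDer ℍ (s ∷ C)) where

    T : Fin (k Sys) → TopInst
    T = top Sys ι

    record Recorded (C : HSeq) (j : Fin (k Sys)) : Set₁ where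
      constructor recorded
      field
        side-ctx  : List Fm
        side-succ : Maybe Fm
        premisses : All (λ Σ → HDer ℍ ((Σ ++ side-ctx ⇒ side-succ) ∷ C)) (prems (T j))
        component : (conc (T j) ++ side-ctx ⇒ side-succ) ∈ C
    open Recorded

    recorded-mono : ∀ {C C' j} → C ⊆ C' → Recorded C j → Recorded C' j
    recorded-mono C⊆C' (recorded Γ Π ps m) =
      recorded Γ Π (All.map (monotoneTail C⊆C') ps) (C⊆C' m)

    -- Once every top rule is recorded in C, Hr_Sys yields C together with the
    -- recorded components, which are contracted into C.
    applyHr : ∀ {C} → (∀ j → Recorded C j) → HDer ℍ C
    applyHr {C} rec =
      contractAll joined C (All.lookup {P = _∈ C} (tabulate⁺ (component ∘ rec)))
        (eexch (++-comm C joined)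
          (rule (Hr Sys) (Hr∈ℍ Sys Sys∈𝕊) (hr ι C (side-ctx ∘ rec) (side-succ ∘ rec))
            (concat⁺ (map⁺ (tabulate⁺ λ j → map⁺ (All.map toEnd (premisses (rec j))))))))
      where
        joined : HSeq
        joined = tabulate (λ j → conc (T j) ++ side-ctx (rec j) ⇒ side-succ (rec j))

    record-step : ∀ {i todo C C'} → C ⊆ C' → Recorded C' i →
                  (∀ j → j ∈ i ∷ todo ⊎ Recorded C j) → ∀ j → j ∈ todo ⊎ Recorded C' j
    record-step {i} C⊆C' new inv j with j ≟ i
    ... | yes refl = inj₂ new
    ... | no j≢i with inv j
    ...   | inj₁ (here j≡i)       = ⊥-elim (j≢i j≡i)
    ...   | inj₁ (there j∈todo)   = inj₁ j∈todo
    ...   | inj₂ r                = inj₂ (recorded-mono C⊆C' r)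

    -- The next pending premiss i is translated with a handler
    -- that records an application of (r_i) and continues with the rest.
    process : (todo : List (Fin (k Sys))) {C : HSeq} → C₀ ⊆ C → s ∈ C →
              (∀ j → j ∈ todo ⊎ Recorded C j) → HDer ℍ C
    process []         _     _   inv = applyHr (λ j → [ (λ ()) , id ]′ (inv j))
    process (i ∷ todo) C₀⊆C s∈C inv = contract s∈C (premiss i handler)
      where
        handler : Handler _ (T i ∷ A)
        handler C⊆C' (there t∈A) ps = O₀ (C⊆C' ∘ C₀⊆C) t∈A ps
        handler C⊆C' (here refl) ps =
          process todo (there ∘ C⊆C' ∘ C₀⊆C) (there (C⊆C' s∈C))
            (record-step (there ∘ C⊆C') (recorded _ _ (All.map (monotoneTail there) ps) (here refl)) inv)

  mutual
    translate : ∀ {A s} → Der 𝕊 A s → ∀ C → Handler C A → HDer ℍ (s ∷ C)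
    translate (lj r ds)         C O = fromEnd (hlj C r (All.map toEnd (translateAll ds C O)))
    translate (exch p d)        C O = fromEnd (iexch C p (toEnd (translate d C O)))
    translate (topR t∈A ds)     C O = O id t∈A (translateAll ds C O)
    translate (botR Sys Sys∈𝕊 ι Ds) C O =
      BottomRule.process Sys Sys∈𝕊 ι O (λ i {C'} O' → translate (Ds i) C' O')
        (allFin (k Sys)) there (here refl) (λ j → inj₁ (∈-allFin j))

    translateAll : ∀ {A} {X : Set} {f : X → Seq} {xs} → All (λ x → Der 𝕊 A (f x)) xs →
                   ∀ C → Handler C A → All (λ x → HDer ℍ (f x ∷ C)) xs
    translateAll []       C O = []
    translateAll (d ∷ ds) C O = translate d C O ∷ translateAll ds C O

theorem1 : (𝕊 : TwoSystem → Set) (ℍ : HRule → Set) →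
           (∀ Sys → 𝕊 Sys → ℍ (Hr Sys)) →
           ∀ {s} → s ⊢LJ+ 𝕊 → HDer ℍ [ s ]
theorem1 𝕊 ℍ Hr∈ℍ d = Translation.translate 𝕊 ℍ Hr∈ℍ d [] (λ _ ())
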